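{- Let $\ell,t$ be positive integers. Let $G$ be a graph such that for every set $S$ of $2t+2\ell$ vertices of $G$ there is a set $X$ of at most $\ell$ vertices of $G$ such that each component of $G-X$ has at most $t$ vertices in $S$. Then for every set $R$ of at most $2t+2\ell$ vertices of $G$ there is a slick tree-decomposition $(B_x:x\in V(T))$ of $G$ with $T$ rooted at $r\in V(T)$, such that $R\subseteq B_r$ and $|B_x|\leq 2t+3\ell$ for each $x\in V(T)$. Moreover, $\Delta(T)\leq 4+\lceil\frac{4\ell}{t}\rceil$ and $\deg_T(r)\leq 3+\lceil\frac{4\ell}{t}\rceil$.
   Context: Graphs are simple, undirected and finite; $\Delta(T)$ is the maximum degree of $T$. A tree-decomposition of $G$ is a collection $(B_x:x\in V(T))$, $T$ a non-empty tree, of subsets of $V(G)$ such that each edge of $G$ has both ends in some $B_x$ and for each $v\in V(G)$ the set $\{x:v\in B_x\}$ induces a non-empty connected subtree of $T$. It is rooted if $T$ is rooted. A rooted tree-decomposition is slick if for each edge $xy\in E(T)$ with $x$ the parent of $y$, and each vertex $v\in B_x\cap B_y$, we have $(N_G(v)\cap B_y)\setminus B_x\neq\emptyset$. -}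

module Defs where

open import Data.Nat using (ℕ; zero; suc; _+_; _≤_)
open import Data.Nat.DivMod using (_/_)
open import Data.Bool using (Bool; true; false; T)
open import Data.Fin using (Fin)
open import Data.Fin.Subset using (Subset; _∈_; _∉_; ∣_∣)
open import Data.Vec using (tabulate)
open import Data.List using (List; []; _∷_; _++_; length)
open import Data.List.Relation.Unary.Linked using (Linked)
open import Data.List.Relation.Unary.Unique.Propositional using (Unique)
open import Data.Product using (Σ; ∃; _×_; _,_)
open import Data.Empty using (⊥)
open import Data.Unit using (⊤)
open import Relation.Nullary using (¬_)
open import Relation.Binary.PropositionalEquality using (_≡_)

record Graph (n : ℕ) : Set where
  field
    adj    : Fin n → Fin n → Bool
    sym    : ∀ u v → adj u v ≡ adj v u
    irrefl : ∀ v → adj v v ≡ false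
open Graph public

Edge : ∀ {n} → Graph n → Fin n → Fin n → Set
Edge G u v = T (adj G u v)

data WalkIn {n} (G : Graph n) (P : Fin n → Set) : Fin n → Fin n → Set where
  here : ∀ {v} → P v → WalkIn G P v v
  step : ∀ {u w v} → P u → Edge G u w → WalkIn G P w v → WalkIn G P u v

ConnectedIn : ∀ {n} → Graph n → (Fin n → Set) → Set
ConnectedIn G P = ∀ u v → P u → P v → WalkIn G P u v

-- C is (the vertex set of) a component of G - X:
-- a non-empty, connected, maximal vertex set of G - X.
IsComponentMinus : ∀ {n} → Graph n → Subset n → Subset n → Set
IsComponentMinus G X C =
  (∀ v → v ∈ C → v ∉ X)
  × (∃ λ v → v ∈ C)
  × ConnectedIn G (λ v → v ∈ C)
  × (∀ u v → u ∈ C → v ∉ X → Edge G u v → v ∈ C)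

HasCycle : ∀ {n} → Graph n → Set
HasCycle G = Σ _ λ v → Σ (List _) λ ws →
  (2 ≤ length ws) × Unique (v ∷ ws) × Linked (Edge G) (v ∷ ws ++ v ∷ [])

-- A tree: connected and acyclic (non-emptiness is provided by the root).
IsTree : ∀ {m} → Graph m → Set
IsTree T = ConnectedIn T (λ _ → ⊤) × ¬ HasCycle T

IsPath : ∀ {n} → Graph n → List (Fin n) → Set
IsPath G vs = Unique vs × Linked (Edge G) vs

StartsAt : ∀ {n} → Fin n → List (Fin n) → Set
StartsAt r vs = ∃ λ ws → vs ≡ r ∷ ws

Parent : ∀ {m} → Graph m → Fin m → Fin m → Fin m → Set
Parent T r x y = Σ (List _) λ qs →
  StartsAt r (qs ++ x ∷ y ∷ []) × IsPath T (qs ++ x ∷ y ∷ [])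

IsTreeDecomposition : ∀ {n m} → Graph n → Graph m → (Fin m → Subset n) → Set
IsTreeDecomposition G T B =
  IsTree T
  × (∀ u v → Edge G u v → ∃ λ x → u ∈ B x × v ∈ B x)
  × (∀ v → (∃ λ x → v ∈ B x) × ConnectedIn T (λ x → v ∈ B x))

IsSlick : ∀ {n m} → Graph n → Graph m → Fin m → (Fin m → Subset n) → Set
IsSlick G T r B = ∀ x y → Parent T r x y → ∀ v → v ∈ B x → v ∈ B y →
  ∃ λ u → Edge G v u × u ∈ B y × u ∉ B x

deg : ∀ {n} → Graph n → Fin n → ℕ
deg G v = ∣ tabulate (adj G v) ∣

-- ⌈ a / b ⌉ for b ≥ 1 (value at b = 0 irrelevant).
ceilDiv : ℕ → ℕ → ℕ
ceilDiv a zero = zero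
ceilDiv a (suc b) = (a + b) / suc b

-- Induction on |W|: build a slick rooted tree-decomposition of G[W] whose root bag contains a
-- given A ⊆ W with |A| ≤ 2t+2ℓ. If |W| ≤ 2t+3ℓ a single bag will do. Otherwise extend A to
-- S ⊆ W with |S| = 2t+2ℓ and let X be the separator for S; the root bag is S ∪ (X ∩ W). The
-- components of G − X are packed first-fit into groups holding at most t vertices of S each,
-- any two groups together holding more than t; hence k groups satisfy k(t+1) ≤ 2|S| and so
-- k ≤ 3 + ⌈4ℓ/t⌉. A group g gives a child: its core (g ∩ W) ∖ S together with its rim, the
-- root-bag vertices with a neighbour in the core. The rim lies in (g ∩ S) ∪ X, so it has at
-- most t+ℓ vertices and the child misses a vertex of S; recursing with the rim plus one core
-- neighbour of each rim vertex as the new A keeps |A| ≤ 2t+2ℓ, and these neighbours make the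
-- edge into the child slick. A child's root gains one neighbour, giving Δ ≤ 4 + ⌈4ℓ/t⌉.

module Submission where

open import Defs hiding (sym)
open import Data.Nat using (ℕ; zero; suc; _+_; _*_; _∸_; _≤_; _<_; z≤n; s≤s; _≤?_)
open import Data.Nat.Properties hiding (_≟_; suc-injective)
open import Data.Nat.DivMod using (m*n/n≡m; /-monoˡ-≤)
open import Data.Nat.ListAction using (sum)
open import Data.Nat.Tactic.RingSolver using (solve-∀)
open import Data.Bool using (Bool; true; false; T; _∧_; _∨_; not)
open import Data.Bool.Properties using (T?; T-∧; T-∨; T-≡; ∨-comm; ∧-comm; ∨-identityʳ; ∧-identityʳ; ∧-distribʳ-∨)
open import Data.Fin using (Fin; zero; suc; toℕ; _↑ˡ_; _↑ʳ_; splitAt)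
open import Data.Fin.Properties using (_≟_; any?; suc-injective; toℕ<n; toℕ-↑ˡ; toℕ-↑ʳ; ↑ˡ-injective; ↑ʳ-injective; splitAt-↑ˡ; splitAt-↑ʳ; splitAt⁻¹-↑ˡ; splitAt⁻¹-↑ʳ)
open import Data.Fin.Subset using (Subset; _∈_; ∣_∣; _⊆_; _∩_)
open import Data.Fin.Subset.Properties using (p⊆q⇒∣p∣≤∣q∣; p⊂q⇒∣p∣<∣q∣; ∣p∣≤n; ∣p∣≡n⇒p≡⊤; ∈⊤)
open import Data.Vec using (_∷_; tabulate; lookup)
open import Data.Vec.Properties using (lookup∘tabulate; tabulate∘lookup; []=⇒lookup; lookup⇒[]=; tabulate-cong)
open import Data.Product using (Σ; ∃; _×_; _,_; proj₁; proj₂)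
open import Data.Sum using (_⊎_; inj₁; inj₂; [_,_]′; map₁; map₂)
open import Data.Empty using (⊥; ⊥-elim)
open import Data.Unit using (tt)
open import Data.List using (List; []; _∷_; _++_; length; foldl; allFin; map)
open import Data.List.Membership.Propositional using () renaming (_∈_ to _∈ₗ_)
open import Data.List.Membership.Propositional.Properties using (∈-allFin)
open import Data.List.Relation.Unary.Any as Any using (Any; here; there)
open import Data.List.Relation.Unary.All as All using (All; []; _∷_)
open import Data.List.Relation.Unary.AllPairs using (AllPairs; []; _∷_)
open import Data.List.Relation.Unary.Linked using (Linked; []; [-]; _∷_)
open import Data.List.Relation.Unary.Unique.Propositional using (Unique)
open import Function using (_∘_; id; flip)
open import Function.Bundles using (Equivalence)
open import Relation.Nullary using (¬_; Dec; yes; no; does)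
open import Relation.Nullary.Decidable using (_×-dec_; ¬?; ⌊_⌋; toWitness; fromWitness; isYes≗does; dec-true; dec-false)
open import Relation.Binary.PropositionalEquality

open Equivalence using (to; from)

-- Finite sets as Boolean predicates

infix 4 _⊆ᵇ_
infixr 6 _∩ᵇ_ _∖ᵇ_
infixr 5 _∪ᵇ_

_⊆ᵇ_ : ∀ {k} → (Fin k → Bool) → (Fin k → Bool) → Set
f ⊆ᵇ g = ∀ x → T (f x) → T (g x)

_∪ᵇ_ _∩ᵇ_ _∖ᵇ_ : ∀ {k} → (Fin k → Bool) → (Fin k → Bool) → Fin k → Bool
(f ∪ᵇ g) x = f x ∨ g x
(f ∩ᵇ g) x = f x ∧ g x
(f ∖ᵇ g) x = f x ∧ not (g x)

⁅_⁆ᵇ : ∀ {k} → Fin k → Fin k → Bool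
⁅ x ⁆ᵇ y = ⌊ x ≟ y ⌋

Disjointᵇ : ∀ {k} → (Fin k → Bool) → (Fin k → Bool) → Set
Disjointᵇ f g = ∀ x → T (f x) → ¬ T (g x)

T-not⇒¬T : ∀ {b} → T (not b) → ¬ T b
T-not⇒¬T {false} _ ()

¬T⇒T-not : ∀ {b} → ¬ T b → T (not b)
¬T⇒T-not {false} _  = tt
¬T⇒T-not {true}  ¬b = ¬b tt

⊆ᵇ-∪ˡ : ∀ {k} (f g : Fin k → Bool) → f ⊆ᵇ f ∪ᵇ g
⊆ᵇ-∪ˡ f g x = from (T-∨ {f x}) ∘ inj₁

⊆ᵇ-∪ʳ : ∀ {k} (f g : Fin k → Bool) → g ⊆ᵇ f ∪ᵇ g
⊆ᵇ-∪ʳ f g x = from (T-∨ {f x}) ∘ inj₂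

Disjointᵇ-sym : ∀ {k} {f g : Fin k → Bool} → Disjointᵇ f g → Disjointᵇ g f
Disjointᵇ-sym d x gx fx = d x fx gx

Disjointᵇ-∪ˡ : ∀ {k} {f g h : Fin k → Bool} → Disjointᵇ f h → Disjointᵇ g h → Disjointᵇ (f ∪ᵇ g) h
Disjointᵇ-∪ˡ {f = f} d₁ d₂ x p = [ d₁ x , d₂ x ]′ (to (T-∨ {f x}) p)

Disjointᵇ-∪ʳ : ∀ {k} {f g h : Fin k → Bool} → Disjointᵇ f g → Disjointᵇ f h → Disjointᵇ f (g ∪ᵇ h)
Disjointᵇ-∪ʳ d₁ d₂ = Disjointᵇ-sym (Disjointᵇ-∪ˡ (Disjointᵇ-sym d₁) (Disjointᵇ-sym d₂))

∃ᵇ : ∀ {k} → (Fin k → Bool) → Bool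
∃ᵇ f = does (any? (T? ∘ f))

∃ᵇ-sound : ∀ {k} {f : Fin k → Bool} → T (∃ᵇ f) → ∃ λ x → T (f x)
∃ᵇ-sound {f = f} with any? (T? ∘ f)
... | yes p = λ _ → p

∃ᵇ-complete : ∀ {k} {f : Fin k → Bool} x → T (f x) → T (∃ᵇ f)
∃ᵇ-complete {f = f} x p with any? (T? ∘ f)
... | yes _ = tt
... | no ¬p = ¬p (x , p)

choose : ∀ {k} → (Fin k → Bool) → Fin k → Fin k
choose f d with any? (T? ∘ f)
... | yes (x , _) = x
... | no  _       = d

choose-sound : ∀ {k} (f : Fin k → Bool) d {x} → T (f x) → T (f (choose f d))
choose-sound f d {x} fx with any? (T? ∘ f)
... | yes (_ , fy) = fy
... | no  ∄        = ⊥-elim (∄ (x , fx))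

≟-false : ∀ {k} {x y : Fin k} → x ≢ y → ⌊ x ≟ y ⌋ ≡ false
≟-false {x = x} {y} x≢y = trans (isYes≗does (x ≟ y)) (dec-false (x ≟ y) x≢y)

≟-injective : ∀ {k l} {f : Fin k → Fin l} → (∀ {x y} → f x ≡ f y → x ≡ y) → ∀ x y →
  ⌊ f x ≟ f y ⌋ ≡ ⌊ x ≟ y ⌋
≟-injective {f = f} f-inj x y with x ≟ y
... | yes refl = trans (isYes≗does (f x ≟ f x)) (dec-true (f x ≟ f x) refl)
... | no x≢y   = ≟-false (x≢y ∘ f-inj)

∈⇒T-lookup : ∀ {k} {p : Subset k} {x} → x ∈ p → T (lookup p x)
∈⇒T-lookup x∈p = from T-≡ ([]=⇒lookup x∈p)

T-lookup⇒∈ : ∀ {k} {p : Subset k} {x} → T (lookup p x) → x ∈ p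
T-lookup⇒∈ {p = p} {x} t = lookup⇒[]= x p (to T-≡ t)

∈-tabulate⁺ : ∀ {k} {f : Fin k → Bool} {x} → T (f x) → x ∈ tabulate f
∈-tabulate⁺ {f = f} {x} = T-lookup⇒∈ ∘ subst T (sym (lookup∘tabulate f x))

∈-tabulate⁻ : ∀ {k} {f : Fin k → Bool} {x} → x ∈ tabulate f → T (f x)
∈-tabulate⁻ {f = f} {x} = subst T (lookup∘tabulate f x) ∘ ∈⇒T-lookup

tabulate-⊆ : ∀ {k} {f g : Fin k → Bool} → f ⊆ᵇ g → tabulate f ⊆ tabulate g
tabulate-⊆ f⊆g p = ∈-tabulate⁺ (f⊆g _ (∈-tabulate⁻ p))

tabulate-∩ : ∀ {k} (f g : Fin k → Bool) → tabulate (f ∩ᵇ g) ≡ tabulate f ∩ tabulate g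
tabulate-∩ {zero}  f g = refl
tabulate-∩ {suc k} f g = cong (f zero ∧ g zero ∷_) (tabulate-∩ (f ∘ suc) (g ∘ suc))

-- Vertex sets are Boolean predicates; counting through `tabulate` makes `count` agree
-- definitionally with `∣_∣` and `deg`.
count : ∀ {k} → (Fin k → Bool) → ℕ
count f = ∣ tabulate f ∣

count-mono : ∀ {k} {f g : Fin k → Bool} → f ⊆ᵇ g → count f ≤ count g
count-mono = p⊆q⇒∣p∣≤∣q∣ ∘ tabulate-⊆

count-< : ∀ {k} {f g : Fin k → Bool} {x} → f ⊆ᵇ g → T (g x) → ¬ T (f x) → count f < count g
count-< {x = x} f⊆g gx ¬fx = p⊂q⇒∣p∣<∣q∣ (tabulate-⊆ f⊆g , x , ∈-tabulate⁺ gx , ¬fx ∘ ∈-tabulate⁻)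

count≤ : ∀ {k} (f : Fin k → Bool) → count f ≤ k
count≤ f = ∣p∣≤n (tabulate f)

count-full : ∀ {k} {f : Fin k → Bool} → k ≤ count f → ∀ x → T (f x)
count-full {f = f} k≤ x = ∈-tabulate⁻ (subst (x ∈_) (sym (∣p∣≡n⇒p≡⊤ (≤-antisym (count≤ f) k≤))) ∈⊤)

count-∪ : ∀ {k} (f g : Fin k → Bool) → count (f ∪ᵇ g) ≤ count f + count g
count-∪ {zero} f g = z≤n
count-∪ {suc k} f g with f zero | g zero | count-∪ (f ∘ suc) (g ∘ suc)
... | true  | true  | ih = s≤s (≤-trans ih (≤-trans (n≤1+n _) (≤-reflexive (sym (+-suc _ _)))))
... | true  | false | ih = s≤s ih
... | false | true  | ih = ≤-trans (s≤s ih) (≤-reflexive (sym (+-suc _ _)))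
... | false | false | ih = ih

count-split : ∀ {k} (f g : Fin k → Bool) → count f ≡ count (f ∩ᵇ g) + count (f ∖ᵇ g)
count-split {zero} f g = refl
count-split {suc k} f g with f zero | g zero | count-split (f ∘ suc) (g ∘ suc)
... | true  | true  | ih = cong suc ih
... | true  | false | ih = trans (cong suc ih) (sym (+-suc _ _))
... | false | _     | ih = ih

count-<-witness : ∀ {k} (f g : Fin k → Bool) → count f < count g → ∃ λ x → T (g x) × ¬ T (f x)
count-<-witness f g lt with any? (λ x → T? (g x) ×-dec ¬? (T? (f x)))
... | yes w = w
... | no ∄ = ⊥-elim (<⇒≱ lt (count-mono g⊆f))
  where
    g⊆f : g ⊆ᵇ f
    g⊆f x gx with T? (f x)
    ... | yes fx = fx
    ... | no ¬fx = ⊥-elim (∄ (x , gx , ¬fx))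

count-↑ : ∀ a {b} (f : Fin (a + b) → Bool) → count f ≡ count (f ∘ (_↑ˡ b)) + count (f ∘ (a ↑ʳ_))
count-↑ zero f = refl
count-↑ (suc a) f with f zero | count-↑ a (f ∘ suc)
... | true  | ih = cong suc ih
... | false | ih = ih

count-cong : ∀ {k} {f g : Fin k → Bool} → (∀ x → f x ≡ g x) → count f ≡ count g
count-cong = cong ∣_∣ ∘ tabulate-cong

count-false : ∀ {k} → count {k} (λ _ → false) ≡ 0
count-false {zero}  = refl
count-false {suc k} = count-false {k}

count-⁅⁆ : ∀ {k} (x : Fin k) → count ⁅ x ⁆ᵇ ≤ 1
count-⁅⁆ {suc k} zero    = s≤s (≤-reflexive (count-false {k}))
count-⁅⁆ {suc k} (suc x) = ≤-trans (≤-reflexive (count-cong (≟-injective suc-injective x))) (count-⁅⁆ x)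

count-insert : ∀ {k} {A : Fin k → Bool} {x} → ¬ T (A x) → count (A ∪ᵇ ⁅ x ⁆ᵇ) ≡ suc (count A)
count-insert {A = A} {x} x∉A = ≤-antisym
  (≤-trans (count-∪ A ⁅ x ⁆ᵇ) (≤-trans (+-monoʳ-≤ (count A) (count-⁅⁆ x)) (≤-reflexive (+-comm (count A) 1))))
  (count-< (⊆ᵇ-∪ˡ A ⁅ x ⁆ᵇ) (⊆ᵇ-∪ʳ A ⁅ x ⁆ᵇ x (fromWitness refl)) x∉A)

subset-grow : ∀ {k} {A W : Fin k → Bool} → A ⊆ᵇ W → count A < count W →
  Σ (Fin k → Bool) λ A′ → A ⊆ᵇ A′ × A′ ⊆ᵇ W × count A′ ≡ suc (count A)
subset-grow {A = A} {W} A⊆W A<W with count-<-witness A W A<W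
... | x , Wx , x∉A = A ∪ᵇ ⁅ x ⁆ᵇ , ⊆ᵇ-∪ˡ A ⁅ x ⁆ᵇ , A+x⊆W , count-insert {A = A} x∉A
  where
    A+x⊆W : A ∪ᵇ ⁅ x ⁆ᵇ ⊆ᵇ W
    A+x⊆W y p = [ A⊆W y , (λ x≡y → subst (T ∘ W) (toWitness x≡y) Wx) ]′ (to (T-∨ {A y}) p)

subset-between : ∀ {k} d {A W : Fin k → Bool} → A ⊆ᵇ W → count A + d ≤ count W →
  Σ (Fin k → Bool) λ S → A ⊆ᵇ S × S ⊆ᵇ W × count S ≡ count A + d
subset-between zero    A⊆W _ = _ , (λ _ → id) , A⊆W , sym (+-identityʳ _)
subset-between (suc d) {A} {W} A⊆W A+d≤W with subset-grow A⊆W (<-≤-trans (m<m+n (count A) (s≤s z≤n)) A+d≤W)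
... | A′ , A⊆A′ , A′⊆W , count-A′
  with subset-between d A′⊆W (subst (λ c → c + d ≤ count W) (sym count-A′) (subst (_≤ count W) (+-suc (count A) d) A+d≤W))
... | S , A′⊆S , S⊆W , count-S =
  S , (λ x → A′⊆S x ∘ A⊆A′ x) , S⊆W , trans count-S (trans (cong (_+ d) count-A′) (sym (+-suc (count A) d)))

count-image : ∀ {k l} (P : Fin k → Bool) (φ : Fin k → Fin l) →
  count (λ u → ∃ᵇ (λ v → P v ∧ ⁅ φ v ⁆ᵇ u)) ≤ count P
count-image {zero}  {l} P φ = ≤-reflexive (count-false {l})
count-image {suc k} P φ with P zero | count-image (P ∘ suc) (φ ∘ suc)
... | true  | ih = ≤-trans (count-∪ ⁅ φ zero ⁆ᵇ (λ u → ∃ᵇ (λ v → P (suc v) ∧ ⁅ φ (suc v) ⁆ᵇ u)))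
                           (+-mono-≤ (count-⁅⁆ (φ zero)) ih)
... | false | ih = ih

count-∩-disjoint : ∀ {k} {g h : Fin k → Bool} (Q : Fin k → Bool) → Disjointᵇ g h →
  count (h ∩ᵇ Q) ≡ count (h ∩ᵇ (Q ∖ᵇ g))
count-∩-disjoint {g = g} {h} Q g∩h≡∅ = count-cong pointwise
  where
    pointwise : ∀ x → h x ∧ Q x ≡ h x ∧ (Q x ∧ not (g x))
    pointwise x with h x in hx | g x in gx
    ... | false | _     = refl
    ... | true  | false = sym (∧-identityʳ (Q x))
    ... | true  | true  = ⊥-elim (g∩h≡∅ x (from T-≡ gx) (from T-≡ hx))

sum-count-disjoint : ∀ {k} (Q : Fin k → Bool) gs → AllPairs Disjointᵇ gs →
  sum (map (λ g → count (g ∩ᵇ Q)) gs) ≤ count Q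
sum-count-disjoint Q []       _         = z≤n
sum-count-disjoint Q (g ∷ gs) (dg ∷ ds) = begin
  count (g ∩ᵇ Q) + sum (map (λ h → count (h ∩ᵇ Q)) gs)         ≡⟨ cong (count (g ∩ᵇ Q) +_) (sum-cong dg) ⟩
  count (g ∩ᵇ Q) + sum (map (λ h → count (h ∩ᵇ (Q ∖ᵇ g))) gs) ≤⟨ +-monoʳ-≤ _ (sum-count-disjoint (Q ∖ᵇ g) gs ds) ⟩
  count (g ∩ᵇ Q) + count (Q ∖ᵇ g)                               ≡⟨ cong (_+ count (Q ∖ᵇ g)) (count-cong λ x → ∧-comm (g x) (Q x)) ⟩
  count (Q ∩ᵇ g) + count (Q ∖ᵇ g)                               ≡⟨ count-split Q g ⟨
  count Q                                                       ∎
  where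
    open ≤-Reasoning
    sum-cong : ∀ {hs} → All (Disjointᵇ g) hs →
      sum (map (λ h → count (h ∩ᵇ Q)) hs) ≡ sum (map (λ h → count (h ∩ᵇ (Q ∖ᵇ g))) hs)
    sum-cong []       = refl
    sum-cong (d ∷ ds) = cong₂ _+_ (count-∩-disjoint Q d) (sum-cong ds)

module _ {A : Set} (f : A → ℕ) (t : ℕ) where

  all-heavy-sum : ∀ xs → All (λ a → suc t ≤ 2 * f a) xs → length xs * suc t ≤ 2 * sum (map f xs)
  all-heavy-sum []       []       = z≤n
  all-heavy-sum (a ∷ xs) (p ∷ ps) =
    ≤-trans (+-mono-≤ p (all-heavy-sum xs ps)) (≤-reflexive (sym (*-distribˡ-+ 2 (f a) (sum (map f xs)))))

  -- If 2 f a ≤ t for the head a, all other elements c have 2 f c > t, and a is paired with the next one.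
  pairwise-heavy-sum : ∀ xs → AllPairs (λ a b → t < f a + f b) xs → 2 ≤ length xs →
    length xs * suc t ≤ 2 * sum (map f xs)
  pairwise-heavy-sum (_ ∷ []) _ (s≤s ())
  pairwise-heavy-sum (a ∷ b ∷ []) ((ab ∷ []) ∷ _) _ =
    ≤-trans (*-monoʳ-≤ 2 ab) (≤-reflexive (cong (λ z → 2 * (f a + z)) (sym (+-identityʳ (f b)))))
  pairwise-heavy-sum (a ∷ b ∷ c ∷ ys) ((ab ∷ ac∷ays) ∷ rest) _ with suc t ≤? 2 * f a
  ... | yes a-heavy = ≤-trans (+-mono-≤ a-heavy (pairwise-heavy-sum (b ∷ c ∷ ys) rest (s≤s (s≤s z≤n))))
                        (≤-reflexive (sym (*-distribˡ-+ 2 (f a) (sum (map f (b ∷ c ∷ ys))))))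
  ... | no  a-light = begin
    suc t + (suc t + length (c ∷ ys) * suc t)    ≡⟨ regroup t (length (c ∷ ys) * suc t) ⟩
    2 * suc t + length (c ∷ ys) * suc t          ≤⟨ +-mono-≤ (*-monoʳ-≤ 2 ab) (all-heavy-sum (c ∷ ys) (All.map light⇒heavy ac∷ays)) ⟩
    2 * (f a + f b) + 2 * sum (map f (c ∷ ys))   ≡⟨ distrib (f a) (f b) (sum (map f (c ∷ ys))) ⟩
    2 * (f a + (f b + sum (map f (c ∷ ys))))     ∎
    where
      open ≤-Reasoning
      regroup : ∀ t l → suc t + (suc t + l) ≡ 2 * suc t + l
      regroup = solve-∀
      distrib : ∀ x y z → 2 * (x + y) + 2 * z ≡ 2 * (x + (y + z))
      distrib = solve-∀
      light⇒heavy : ∀ {c} → t < f a + f c → suc t ≤ 2 * f c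
      light⇒heavy {c} q = +-cancelˡ-≤ t (suc t) (2 * f c) (begin
        t + suc t           ≤⟨ n≤1+n _ ⟩
        suc (t + suc t)     ≡⟨ double-suc t ⟨
        2 * suc t           ≤⟨ *-monoʳ-≤ 2 q ⟩
        2 * (f a + f c)     ≡⟨ *-distribˡ-+ 2 (f a) (f c) ⟩
        2 * f a + 2 * f c   ≤⟨ +-monoˡ-≤ (2 * f c) (≤-pred (≰⇒> a-light)) ⟩
        t + 2 * f c         ∎)
        where
          double-suc : ∀ t → 2 * suc t ≡ suc (t + suc t)
          double-suc = solve-∀

≤-ceilDiv : ∀ a t′ d → d * suc t′ ≤ a + t′ → d ≤ ceilDiv a (suc t′)
≤-ceilDiv a t′ d h = subst (_≤ ceilDiv a (suc t′)) (m*n/n≡m d (suc t′)) (/-monoˡ-≤ (suc t′) h)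

few-groups : ∀ ℓ t′ k → k * suc (suc t′) ≤ 2 * (2 * suc t′ + 2 * ℓ) → k ≤ 3 + ceilDiv (4 * ℓ) (suc t′)
few-groups ℓ t′ 0 _ = z≤n
few-groups ℓ t′ 1 _ = s≤s z≤n
few-groups ℓ t′ 2 _ = s≤s (s≤s z≤n)
few-groups ℓ t′ (suc (suc (suc d))) h =
  +-monoʳ-≤ 3 (≤-ceilDiv (4 * ℓ) t′ d (+-cancelʳ-≤ (3 * t′ + 4) (d * suc t′) (4 * ℓ + t′) (begin
    d * suc t′ + (3 * t′ + 4)               ≤⟨ +-monoʳ-≤ (d * suc t′) (m≤n+m (3 * t′ + 4) (d + 2)) ⟩
    d * suc t′ + (d + 2 + (3 * t′ + 4))     ≡⟨ lhs d t′ ⟩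
    (3 + d) * suc (suc t′)                  ≤⟨ h ⟩
    2 * (2 * suc t′ + 2 * ℓ)                ≡⟨ rhs t′ ℓ ⟩
    4 * ℓ + t′ + (3 * t′ + 4)               ∎)))
  where
    open ≤-Reasoning
    lhs : ∀ d t′ → d * suc t′ + (d + 2 + (3 * t′ + 4)) ≡ (3 + d) * suc (suc t′)
    lhs = solve-∀
    rhs : ∀ t′ ℓ → 2 * (2 * suc t′ + 2 * ℓ) ≡ 4 * ℓ + t′ + (3 * t′ + 4)
    rhs = solve-∀

edge-sym : ∀ {n} (G : Graph n) {u v} → Edge G u v → Edge G v u
edge-sym G {u} {v} = subst T (Graph.sym G u v)

module _ {n} {G : Graph n} where

  walk-source : ∀ {P u v} → WalkIn G P u v → P u
  walk-source (here p)     = p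
  walk-source (step p _ _) = p

  walk-target : ∀ {P u v} → WalkIn G P u v → P v
  walk-target (here p)     = p
  walk-target (step _ _ w) = walk-target w

  walk-snoc : ∀ {P u v w} → WalkIn G P u v → Edge G v w → P w → WalkIn G P u w
  walk-snoc (here p)      e q = step p e (here q)
  walk-snoc (step p e′ w) e q = step p e′ (walk-snoc w e q)

  walk-++ : ∀ {P u v w} → WalkIn G P u v → WalkIn G P v w → WalkIn G P u w
  walk-++ (here _)      w′ = w′
  walk-++ (step p e w) w′ = step p e (walk-++ w w′)

  walk-reverse : ∀ {P u v} → WalkIn G P u v → WalkIn G P v u
  walk-reverse (here p)     = here p
  walk-reverse (step p e w) = walk-snoc (walk-reverse w) (edge-sym G e) p

  walk-map : ∀ {P Q : Fin n → Set} {u v} → (∀ x → P x → Q x) → WalkIn G P u v → WalkIn G Q u v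
  walk-map f (here p)     = here (f _ p)
  walk-map f (step p e w) = step (f _ p) e (walk-map f w)

-- Rooted trees given by parent maps

-- Node `suc i` has parent `parent i` and `zero` is the root; parents precede their children.
record RootedTree : Set where
  constructor rootedTree
  field
    size    : ℕ
    parent  : Fin size → Fin (suc size)
    parent≤ : ∀ i → toℕ (parent i) ≤ toℕ i

module Tree (D : RootedTree) where
  open RootedTree D

  Node : Set
  Node = Fin (suc size)

  isParentOf : Node → Node → Bool
  isParentOf x zero    = false
  isParentOf x (suc j) = ⌊ parent j ≟ x ⌋

  adjacent : Node → Node → Bool
  adjacent x y = isParentOf x y ∨ isParentOf y x

  isParentOf-irrefl : ∀ x → isParentOf x x ≡ false
  isParentOf-irrefl zero    = refl
  isParentOf-irrefl (suc j) with parent j ≟ suc j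
  ... | yes p≡j = ⊥-elim (<-irrefl (cong toℕ p≡j) (s≤s (parent≤ j)))
  ... | no _    = refl

  graph : Graph (suc size)
  graph = record
    { adj    = adjacent
    ; sym    = λ x y → ∨-comm (isParentOf x y) (isParentOf y x)
    ; irrefl = λ x → cong₂ _∨_ (isParentOf-irrefl x) (isParentOf-irrefl x)
    }

  E : Node → Node → Set
  E = Edge graph

  ParentOf : Node → Node → Set
  ParentOf x y = ∃ λ j → y ≡ suc j × parent j ≡ x

  edge-to-parent : ∀ {x y} → ParentOf y x → E x y
  edge-to-parent (j , refl , refl) = from (T-∨ {isParentOf (suc j) (parent j)}) (inj₂ (fromWitness refl))

  edge⇒ParentOf : ∀ {x y} → E x y → ParentOf x y ⊎ ParentOf y x
  edge⇒ParentOf {x} {y} e with to (T-∨ {isParentOf x y}) e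
  edge⇒ParentOf {x} {suc j} e | inj₁ p = inj₁ (j , refl , toWitness p)
  edge⇒ParentOf {suc j} {y} e | inj₂ p = inj₂ (j , refl , toWitness p)

  ParentOf⇒< : ∀ {x y} → ParentOf x y → toℕ x < toℕ y
  ParentOf⇒< (j , refl , refl) = s≤s (parent≤ j)

  parent-unique : ∀ {x x′ y} → ParentOf x y → ParentOf x′ y → x ≡ x′
  parent-unique (j , refl , refl) (j′ , e , refl) with suc-injective e
  ... | refl = refl

  root-orphan : ∀ {x} → ¬ ParentOf x zero
  root-orphan (_ , () , _)

  HasTop : (Node → Set) → Set
  HasTop P = Σ Node λ top → P top × (P zero → zero ≡ top)
    × (∀ j → P (suc j) → suc j ≡ top ⊎ P (parent j))

  walk-to-top : ∀ {P} ((top , _ , at-root , climb) : HasTop P) →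
    ∀ k x → toℕ x < k → P x → WalkIn graph P x top
  walk-to-top (_ , _ , at-root , _) (suc k) zero _ px = subst (WalkIn graph _ zero) (at-root px) (here px)
  walk-to-top c@(_ , _ , _ , climb) (suc k) (suc j) (s≤s lt) px with climb j px
  ... | inj₁ j≡top = subst (WalkIn graph _ (suc j)) j≡top (here px)
  ... | inj₂ pj    = step px (edge-to-parent (j , refl , refl))
                       (walk-to-top c k (parent j) (≤-trans (s≤s (parent≤ j)) lt) pj)

  HasTop⇒connected : ∀ {P} → HasTop P → ConnectedIn graph P
  HasTop⇒connected c u v pu pv =
    walk-++ (walk-to-top c _ u ≤-refl pu) (walk-reverse (walk-to-top c _ v ≤-refl pv))

  second : List Node → Node → Node → Node
  second []      y _ = y
  second (p ∷ _) _ _ = p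

  linked-second : ∀ a ps y z → Linked E (a ∷ ps ++ y ∷ z ∷ []) → E a (second ps y z)
  linked-second a []      y z (e ∷ _) = e
  linked-second a (p ∷ _) y z (e ∷ _) = e

  all-second : ∀ {P : Node → Set} ps y z → All P (ps ++ y ∷ z ∷ []) → P (second ps y z)
  all-second []      y z (p ∷ _) = p
  all-second (_ ∷ _) y z (p ∷ _) = p

  all-last-two : ∀ {P : Node → Set} ps y z → All P (ps ++ y ∷ z ∷ []) → P y × P z
  all-last-two []       y z (py ∷ pz ∷ []) = py , pz
  all-last-two (_ ∷ ps) y z (_ ∷ ap)       = all-last-two ps y z ap

  descending : ∀ a ps y z → Unique (a ∷ ps ++ y ∷ z ∷ []) → Linked E (a ∷ ps ++ y ∷ z ∷ []) →
    ParentOf a (second ps y z) → toℕ a < toℕ z × ParentOf y z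
  descending a [] y z ((_ ∷ a≢z ∷ []) ∷ _) (_ ∷ e ∷ [-]) p with edge⇒ParentOf e
  ... | inj₁ q = <-trans (ParentOf⇒< p) (ParentOf⇒< q) , q
  ... | inj₂ q = ⊥-elim (a≢z (parent-unique p q))
  descending a (b ∷ ps) y z ((_ ∷ a≢) ∷ u) (_ ∷ l) p with edge⇒ParentOf (linked-second b ps y z l)
  ... | inj₂ q = ⊥-elim (all-second ps y z a≢ (parent-unique p q))
  ... | inj₁ q = Data.Product.map₁ (<-trans (ParentOf⇒< p)) (descending b ps y z u l q)

  ascending : ∀ a ps y z → Unique (a ∷ ps ++ y ∷ z ∷ []) → Linked E (a ∷ ps ++ y ∷ z ∷ []) →
    ParentOf z y → toℕ z < toℕ a
  ascending a ps y z u l q with edge⇒ParentOf (linked-second a ps y z l)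
  ... | inj₁ p = ⊥-elim (<-asym (ParentOf⇒< q) (ParentOf⇒< (proj₂ (descending a ps y z u l p))))
  ascending a []       y z u        l        q | inj₂ p = <-trans (ParentOf⇒< q) (ParentOf⇒< p)
  ascending a (b ∷ ps) y z (_ ∷ u) (_ ∷ l) q | inj₂ p = <-trans (ascending b ps y z u l q) (ParentOf⇒< p)

  last-two : ∀ (ws : List Node) → 2 ≤ length ws → ∃ λ ((ps , y , z) : List Node × Node × Node) → ws ≡ ps ++ y ∷ z ∷ []
  last-two (_ ∷ []) (s≤s ())
  last-two (a ∷ b ∷ []) _ = ([] , a , b) , refl
  last-two (a ∷ b ∷ c ∷ ws) _ with last-two (b ∷ c ∷ ws) (s≤s (s≤s z≤n))
  ... | (ps , y , z) , eq = (a ∷ ps , y , z) , cong (a ∷_) eq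

  linked-close : ∀ a ps y z v → Linked E (a ∷ (ps ++ y ∷ z ∷ []) ++ v ∷ []) →
    Linked E (a ∷ ps ++ y ∷ z ∷ []) × E y z × E z v
  linked-close a []       y z v (e₁ ∷ e₂ ∷ e₃ ∷ [-]) = (e₁ ∷ e₂ ∷ [-]) , e₂ , e₃
  linked-close a (b ∷ ps) y z v (e ∷ l) with linked-close b ps y z v l
  ... | l′ , eyz , ezv = (e ∷ l′) , eyz , ezv

  acyclic : ¬ HasCycle graph
  acyclic (v , ws , 2≤ , u@(v≢ ∷ u′) , l) with last-two ws 2≤
  ... | (ps , y , z) , refl with linked-close v ps y z v l
  ... | l′ , eyz , ezv with edge⇒ParentOf (linked-second v ps y z l′) | edge⇒ParentOf ezv
  ... | inj₁ p | inj₁ q = <-asym (proj₁ (descending v ps y z u l′ p)) (ParentOf⇒< q)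
  ... | inj₁ p | inj₂ q = proj₁ (all-last-two ps y z v≢) (parent-unique q (proj₂ (descending v ps y z u l′ p)))
  ... | inj₂ p | inj₁ q = second≢z ps u′ (parent-unique p q)
    where
      second≢z : ∀ ps → Unique (ps ++ y ∷ z ∷ []) → second ps y z ≢ z
      second≢z []       ((y≢z ∷ []) ∷ _) = y≢z
      second≢z (_ ∷ ps) (b≢ ∷ _)         = proj₂ (all-last-two ps y z b≢)
  ... | inj₂ p | inj₂ q with edge⇒ParentOf eyz
  ...   | inj₁ r = proj₁ (all-last-two ps y z v≢) (parent-unique q r)
  ...   | inj₂ r = <-asym (ascending v ps y z u l′ r) (ParentOf⇒< q)

  isTree : IsTree graph
  isTree = HasTop⇒connected (zero , tt , (λ _ → refl) , λ _ _ → inj₂ tt) , acyclic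

  Parent⇒ParentOf : ∀ {x y} → Parent graph zero x y → ParentOf x y
  Parent⇒ParentOf ([] , (_ , refl) , _ , e ∷ _) with edge⇒ParentOf e
  ... | inj₁ p = p
  ... | inj₂ p = ⊥-elim (root-orphan p)
  Parent⇒ParentOf (q ∷ qs , (_ , refl) , u , l) with edge⇒ParentOf (linked-second zero qs _ _ l)
  ... | inj₁ p = proj₂ (descending zero qs _ _ u l p)
  ... | inj₂ p = ⊥-elim (root-orphan p)

SlickStep : ∀ {n} → Graph n → (Fin n → Bool) → (Fin n → Bool) → Set
SlickStep G P C = ∀ v → T (P v) → T (C v) → ∃ λ u → Edge G v u × T (C u) × ¬ T (P u)

BagsConnected : ∀ {n} (D : RootedTree) → (Tree.Node D → Fin n → Bool) → Fin n → Set
BagsConnected D bag v = Tree.HasTop D (λ x → T (bag x v)) ⊎ (∀ x → ¬ T (bag x v))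

-- graft hangs the root of B below the root of A; the nodes of A keep their indices.
module Graft (A B : RootedTree) where
  module TA = Tree A
  module TB = Tree B
  open RootedTree A using () renaming (size to a; parent to parentA; parent≤ to parentA≤)
  open RootedTree B using () renaming (size to b; parent to parentB; parent≤ to parentB≤)

  Node : Set
  Node = Fin (suc (a + suc b))

  inA : TA.Node → Node
  inA x = x ↑ˡ suc b

  inB : TB.Node → Node
  inB y = suc a ↑ʳ y

  inA-injective : ∀ {x x′} → inA x ≡ inA x′ → x ≡ x′
  inA-injective = ↑ˡ-injective (suc b) _ _

  inB-injective : ∀ {y y′} → inB y ≡ inB y′ → y ≡ y′
  inB-injective = ↑ʳ-injective (suc a) _ _

  inA≢inB : ∀ {x y} → inA x ≢ inB y
  inA≢inB {x} {y} eq = <-irrefl (cong toℕ eq)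
    (subst₂ _<_ (sym (toℕ-↑ˡ x (suc b))) (sym (toℕ-↑ʳ (suc a) y)) (<-≤-trans (toℕ<n x) (m≤m+n (suc a) (toℕ y))))

  parentInB : TB.Node → Node
  parentInB zero    = zero
  parentInB (suc k) = inB (parentB k)

  parent : Fin (a + suc b) → Node
  parent j = [ inA ∘ parentA , parentInB ]′ (splitAt a j)

  parent-inA : ∀ i → parent (i ↑ˡ suc b) ≡ inA (parentA i)
  parent-inA i rewrite splitAt-↑ˡ a i (suc b) = refl

  parent-inB : ∀ k → parent (a ↑ʳ k) ≡ parentInB k
  parent-inB k rewrite splitAt-↑ʳ a (suc b) k = refl

  data NonRoot : Fin (a + suc b) → Set where
    nonRootA : ∀ i → NonRoot (i ↑ˡ suc b)
    nonRootB : ∀ k → NonRoot (a ↑ʳ k)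

  nonRoot : ∀ j → NonRoot j
  nonRoot j with splitAt a j in eq
  ... | inj₁ i = subst NonRoot (splitAt⁻¹-↑ˡ eq) (nonRootA i)
  ... | inj₂ k = subst NonRoot (splitAt⁻¹-↑ʳ eq) (nonRootB k)

  parent≤ : ∀ j → toℕ (parent j) ≤ toℕ j
  parent≤ j with nonRoot j
  ... | nonRootA i = subst₂ _≤_ (sym (trans (cong toℕ (parent-inA i)) (toℕ-↑ˡ (parentA i) (suc b))))
                                (sym (toℕ-↑ˡ i (suc b))) (parentA≤ i)
  ... | nonRootB zero = subst (_≤ toℕ (a ↑ʳ zero)) (sym (cong toℕ (parent-inB zero))) z≤n
  ... | nonRootB (suc k) = subst₂ _≤_ (sym (trans (cong toℕ (parent-inB (suc k))) (toℕ-↑ʳ (suc a) (parentB k))))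
                                      (sym (toℕ-↑ʳ a (suc k)))
                                      (≤-trans (s≤s (+-monoʳ-≤ a (parentB≤ k))) (≤-reflexive (sym (+-suc a (toℕ k)))))

  graft : RootedTree
  graft = rootedTree (a + suc b) parent parent≤

  module T = Tree graft

  data Part : Node → Set where
    partA : ∀ x → Part (inA x)
    partB : ∀ y → Part (inB y)

  part : ∀ x → Part x
  part zero = partA zero
  part (suc j) with nonRoot j
  ... | nonRootA i = partA (suc i)
  ... | nonRootB k = partB k

  merge : ∀ {X : Set} → (TA.Node → X) → (TB.Node → X) → Node → X
  merge f g zero    = f zero
  merge f g (suc j) = [ f ∘ suc , g ]′ (splitAt a j)

  merge-inA : ∀ {X : Set} (f : TA.Node → X) g x → merge f g (inA x) ≡ f x
  merge-inA f g zero    = refl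
  merge-inA f g (suc i) rewrite splitAt-↑ˡ a i (suc b) = refl

  merge-inB : ∀ {X : Set} f (g : TB.Node → X) y → merge f g (inB y) ≡ g y
  merge-inB f g y rewrite splitAt-↑ʳ a (suc b) y = refl

  merge-elim : ∀ {X : Set} {f : TA.Node → X} {g} (Q : X → Set) →
    (∀ x → Q (f x)) → (∀ y → Q (g y)) → ∀ z → Q (merge f g z)
  merge-elim {f = f} {g} Q qf qg z with part z
  ... | partA x = subst Q (sym (merge-inA f g x)) (qf x)
  ... | partB y = subst Q (sym (merge-inB f g y)) (qg y)

  isParent-AA : ∀ x x′ → T.isParentOf (inA x) (inA x′) ≡ TA.isParentOf x x′
  isParent-AA x zero    = refl
  isParent-AA x (suc i) rewrite parent-inA i = ≟-injective inA-injective (parentA i) x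

  isParent-BA : ∀ y x → T.isParentOf (inB y) (inA x) ≡ false
  isParent-BA y zero    = refl
  isParent-BA y (suc i) rewrite parent-inA i = ≟-false inA≢inB

  isParent-AB : ∀ x y → T.isParentOf (inA x) (inB y) ≡ ⌊ y ≟ zero ⌋ ∧ ⌊ x ≟ zero ⌋
  isParent-AB zero    zero    rewrite parent-inB zero = refl
  isParent-AB (suc i) zero    rewrite parent-inB zero = refl
  isParent-AB x       (suc k) rewrite parent-inB (suc k) = ≟-false (inA≢inB ∘ sym)

  isParent-BB : ∀ y y′ → T.isParentOf (inB y) (inB y′) ≡ TB.isParentOf y y′
  isParent-BB y zero    rewrite parent-inB zero = ≟-false (inA≢inB {zero} {y})
  isParent-BB y (suc k) rewrite parent-inB (suc k) = ≟-injective inB-injective (parentB k) y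

  degree-inA : ∀ x → deg T.graph (inA x) ≡ deg TA.graph x + count {suc b} (λ y → ⌊ y ≟ zero ⌋ ∧ ⌊ x ≟ zero ⌋)
  degree-inA x = trans (count-↑ (suc a) (T.adjacent (inA x)))
    (cong₂ _+_ (count-cong λ x′ → cong₂ _∨_ (isParent-AA x x′) (isParent-AA x′ x))
               (count-cong λ y → trans (cong₂ _∨_ (isParent-AB x y) (isParent-BA y x)) (∨-identityʳ _)))

  degree-inB : ∀ y → deg T.graph (inB y) ≡ count {suc a} (λ x → ⌊ x ≟ zero ⌋ ∧ ⌊ y ≟ zero ⌋) + deg TB.graph y
  degree-inB y = trans (count-↑ (suc a) (T.adjacent (inB y)))
    (cong₂ _+_ (count-cong λ x → cong₂ _∨_ (isParent-BA y x) (trans (isParent-AB x y) (∧-comm ⌊ y ≟ zero ⌋ ⌊ x ≟ zero ⌋)))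
               (count-cong λ y′ → cong₂ _∨_ (isParent-BB y y′) (isParent-BB y′ y)))

  degree-root : deg T.graph zero ≡ suc (deg TA.graph zero)
  degree-root = trans (degree-inA zero) (trans (cong (deg TA.graph zero +_) (cong suc (count-false {b}))) (+-comm _ 1))

  degree-nonRoot≤ : ∀ {d} → (∀ i → deg TA.graph (suc i) ≤ d) → suc (deg TB.graph zero) ≤ d →
    (∀ k → deg TB.graph (suc k) ≤ d) → ∀ j → deg T.graph (suc j) ≤ d
  degree-nonRoot≤ {d} degA degB₀ degB j with nonRoot j
  ... | nonRootA i = subst (_≤ d) (sym (trans (degree-inA (suc i)) (trans (cong (_ +_) (count-false {suc b})) (+-identityʳ _)))) (degA i)
  ... | nonRootB zero = subst (_≤ d) (sym (trans (degree-inB zero) (cong (_+ deg TB.graph zero) (cong suc (count-false {a}))))) degB₀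
  ... | nonRootB (suc k) = subst (_≤ d) (sym (trans (degree-inB (suc k)) (cong (_+ deg TB.graph (suc k)) (count-false {suc a})))) (degB k)

  module _ {n} (bagA : TA.Node → Fin n → Bool) (bagB : TB.Node → Fin n → Bool) where

    bag : Node → Fin n → Bool
    bag = merge bagA bagB

    graft-slick : ∀ (G : Graph n) →
      (∀ i → SlickStep G (bagA (parentA i)) (bagA (suc i))) →
      (∀ k → SlickStep G (bagB (parentB k)) (bagB (suc k))) →
      SlickStep G (bagA zero) (bagB zero) →
      ∀ j → SlickStep G (bag (parent j)) (bag (suc j))
    graft-slick G slickA slickB slick₀ j with nonRoot j
    ... | nonRootA i = subst₂ (SlickStep G)
      (sym (trans (cong bag (parent-inA i)) (merge-inA bagA bagB (parentA i)))) (sym (merge-inA bagA bagB (suc i))) (slickA i)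
    ... | nonRootB zero = subst₂ (SlickStep G)
      (sym (cong bag (parent-inB zero))) (sym (merge-inB bagA bagB zero)) slick₀
    ... | nonRootB (suc k) = subst₂ (SlickStep G)
      (sym (trans (cong bag (parent-inB (suc k))) (merge-inB bagA bagB (parentB k)))) (sym (merge-inB bagA bagB (suc k))) (slickB k)

    module _ (v : Fin n) where

      P : Node → Set
      P x = T (bag x v)

      fromA : ∀ x → T (bagA x v) → P (inA x)
      fromA x = subst (λ s → T (s v)) (sym (merge-inA bagA bagB x))

      fromB : ∀ y → T (bagB y v) → P (inB y)
      fromB y = subst (λ s → T (s v)) (sym (merge-inB bagA bagB y))

      toA : ∀ x → P (inA x) → T (bagA x v)
      toA x = subst (λ s → T (s v)) (merge-inA bagA bagB x)

      toB : ∀ y → P (inB y) → T (bagB y v)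
      toB y = subst (λ s → T (s v)) (merge-inB bagA bagB y)

      climb : ∀ top →
        (∀ i → T (bagA (suc i) v) → inA (suc i) ≡ top ⊎ T (bagA (parentA i) v)) →
        (T (bagB zero v) → inB zero ≡ top ⊎ T (bagA zero v)) →
        (∀ k → T (bagB (suc k) v) → inB (suc k) ≡ top ⊎ T (bagB (parentB k) v)) →
        ∀ j → P (suc j) → suc j ≡ top ⊎ P (parent j)
      climb top climbA climb₀ climbB j p with nonRoot j
      ... | nonRootA i = map₂ (subst P (sym (parent-inA i)) ∘ fromA (parentA i)) (climbA i (toA (suc i) p))
      ... | nonRootB zero = map₂ (subst P (sym (parent-inB zero))) (climb₀ (toB zero p))
      ... | nonRootB (suc k) = map₂ (subst P (sym (parent-inB (suc k))) ∘ fromB (parentB k)) (climbB k (toB (suc k) p))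

      graft-connected : BagsConnected A bagA v → BagsConnected B bagB v →
        ((∃ λ x → T (bagA x v)) → (∃ λ y → T (bagB y v)) → T (bagA zero v) × T (bagB zero v)) →
        BagsConnected graft bag v
      graft-connected (inj₂ ∉A) (inj₂ ∉B) _ = inj₂ (merge-elim {f = bagA} {bagB} (λ s → ¬ T (s v)) ∉A ∉B)
      graft-connected (inj₂ ∉A) (inj₁ (top , p , root , climbB)) _ =
        inj₁ (inB top , fromB top p , ⊥-elim ∘ ∉A zero ,
              climb (inB top) (λ i → ⊥-elim ∘ ∉A (suc i)) (inj₁ ∘ cong inB ∘ root) (λ k → map₁ (cong inB) ∘ climbB k))
      graft-connected (inj₁ (top , p , root , climbA)) (inj₂ ∉B) _ =
        inj₁ (inA top , fromA top p , cong inA ∘ root ,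
              climb (inA top) (λ i → map₁ (cong inA) ∘ climbA i) (⊥-elim ∘ ∉B zero) (λ k → ⊥-elim ∘ ∉B (suc k)))
      graft-connected (inj₁ (top , p , root , climbA)) (inj₁ (topB , pB , rootB , climbB)) meet
        with meet (top , p) (topB , pB)
      ... | p₀ , pB₀ =
        inj₁ (inA top , fromA top p , cong inA ∘ root ,
              climb (inA top) (λ i → map₁ (cong inA) ∘ climbA i) (λ _ → inj₂ p₀)
                (λ k → map₁ (λ k≡top → ⊥-elim (suc≢zero (trans k≡top (sym (rootB pB₀))))) ∘ climbB k))
        where
          suc≢zero : ∀ {k} {i : Fin k} → suc i ≢ zero
          suc≢zero ()

-- Components of G − X

module Components {n} (G : Graph n) (X : Fin n → Bool) where

  Outside : Fin n → Set
  Outside v = ¬ T (X v)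

  Closed : (Fin n → Bool) → Set
  Closed C = (∀ v → T (C v) → Outside v) × (∀ u v → T (C u) → Outside v → Edge G u v → T (C v))

  frontier : (Fin n → Bool) → Fin n → Bool
  frontier K v = not (X v) ∧ ∃ᵇ (λ u → K u ∧ adj G u v)

  grow : (Fin n → Bool) → Fin n → Bool
  grow K = K ∪ᵇ frontier K

  saturate : ℕ → (Fin n → Bool) → Fin n → Bool
  saturate zero    K = K
  saturate (suc k) K with any? (λ v → T? (grow K v) ×-dec ¬? (T? (K v)))
  ... | yes _ = saturate k (grow K)
  ... | no  _ = K

  -- Each round that changes K adds a vertex, so n rounds reach a fixed point of grow.
  saturate-saturated : ∀ k K → n ≤ count K + k → grow (saturate k K) ⊆ᵇ saturate k K
  saturate-saturated zero K n≤ v _ = count-full (subst (n ≤_) (+-identityʳ (count K)) n≤) v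
  saturate-saturated (suc k) K n≤ with any? (λ v → T? (grow K v) ×-dec ¬? (T? (K v)))
  ... | yes (v , new , old) = saturate-saturated k (grow K)
          (≤-trans n≤ (≤-trans (≤-reflexive (+-suc (count K) k)) (+-monoˡ-≤ k (count-< (⊆ᵇ-∪ˡ K (frontier K)) new old))))
  ... | no ∄ = λ v g → decide v g
    where
      decide : ∀ v → T (grow K v) → T (K v)
      decide v g with T? (K v)
      ... | yes k = k
      ... | no ¬k = ⊥-elim (∄ (v , g , ¬k))

  saturate-⊇ : ∀ k K → K ⊆ᵇ saturate k K
  saturate-⊇ zero K v p = p
  saturate-⊇ (suc k) K v p with any? (λ v → T? (grow K v) ×-dec ¬? (T? (K v)))
  ... | yes _ = saturate-⊇ k (grow K) v (⊆ᵇ-∪ˡ K (frontier K) v p)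
  ... | no  _ = p

  WalksFrom : Fin n → (Fin n → Bool) → Set
  WalksFrom u K = ∀ v → T (K v) → WalkIn G Outside u v

  grow-walks : ∀ {u K} → WalksFrom u K → WalksFrom u (grow K)
  grow-walks {u} {K} walks v p with to (T-∨ {K v}) p
  ... | inj₁ q = walks v q
  ... | inj₂ q with to (T-∧ {not (X v)}) q
  ... | out , ∃e with ∃ᵇ-sound ∃e
  ... | w , r with to (T-∧ {K w}) r
  ... | kw , e = walk-snoc (walks w kw) e (T-not⇒¬T out)

  saturate-walks : ∀ {u} k K → WalksFrom u K → WalksFrom u (saturate k K)
  saturate-walks zero K walks = walks
  saturate-walks (suc k) K walks with any? (λ v → T? (grow K v) ×-dec ¬? (T? (K v)))
  ... | yes _ = saturate-walks k (grow K) (grow-walks walks)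
  ... | no  _ = walks

  component : Fin n → Fin n → Bool
  component u = saturate n ⁅ u ⁆ᵇ

  component-self : ∀ u → T (component u u)
  component-self u = saturate-⊇ n _ u (fromWitness refl)

  component-walks : ∀ {u} → Outside u → WalksFrom u (component u)
  component-walks {u} out = saturate-walks n _ λ v u≡v → subst (WalkIn G Outside u) (toWitness u≡v) (here out)

  component-closed : ∀ {u} → Outside u → Closed (component u)
  component-closed {u} out =
      (λ v p → walk-target (component-walks out v p))
    , (λ w v p out-v e → saturate-saturated n _ (m≤n+m n _) v
         (⊆ᵇ-∪ʳ (component u) (frontier (component u)) v (from (T-∧ {not (X v)})
           (¬T⇒T-not out-v , ∃ᵇ-complete w (from (T-∧ {component u w}) (p , e))))))

  closed-walk : ∀ {C u v} → Closed C → T (C u) → WalkIn G Outside u v → WalkIn G (λ x → T (C x)) u v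
  closed-walk c p (here _)     = here p
  closed-walk c p (step _ e w) = step p e (closed-walk c (proj₂ c _ _ p (walk-source w) e) w)

  component-disjoint : ∀ {C u} → Outside u → Closed C → ¬ T (C u) → Disjointᵇ C (component u)
  component-disjoint out c ¬Cu v Cv uv =
    ¬Cu (walk-target (closed-walk c Cv (walk-reverse (component-walks out v uv))))

  component-isComponent : ∀ (Xs : Subset n) → lookup Xs ≡ X → ∀ {u} → Outside u →
    IsComponentMinus G Xs (tabulate (component u))
  component-isComponent Xs refl {u} out =
      (λ v p q → proj₁ closed v (∈-tabulate⁻ p) (∈⇒T-lookup q))
    , (u , ∈-tabulate⁺ (component-self u))
    , (λ v w p q → walk-map (λ _ → ∈-tabulate⁺) (closed-walk closed (∈-tabulate⁻ p)
         (walk-++ (walk-reverse (component-walks out v (∈-tabulate⁻ p))) (component-walks out w (∈-tabulate⁻ q)))))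
    , (λ v w p v∉ e → ∈-tabulate⁺ (proj₂ closed v w (∈-tabulate⁻ p) (v∉ ∘ T-lookup⇒∈) e))
    where
      closed = component-closed out

-- Packing components into groups

module Grouping {n} (G : Graph n) (X S : Fin n → Bool) (t : ℕ) where
  open Components G X

  weight : (Fin n → Bool) → ℕ
  weight g = count (g ∩ᵇ S)

  Heavy : (Fin n → Bool) → (Fin n → Bool) → Set
  Heavy g h = t < weight g + weight h

  insert : (Fin n → Bool) → List (Fin n → Bool) → List (Fin n → Bool)
  insert K []       = K ∷ []
  insert K (g ∷ gs) with weight g + weight K ≤? t
  ... | yes _ = (g ∪ᵇ K) ∷ gs
  ... | no  _ = g ∷ insert K gs

  ⋃ᵇ : List (Fin n → Bool) → Fin n → Bool
  ⋃ᵇ []       v = false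
  ⋃ᵇ (g ∷ gs) v = g v ∨ ⋃ᵇ gs v

  record Grouped (gs : List (Fin n → Bool)) : Set where
    field
      closed   : All Closed gs
      light    : All (λ g → weight g ≤ t) gs
      disjoint : AllPairs Disjointᵇ gs
      heavy    : AllPairs Heavy gs

  weight-∪ˡ : ∀ g h → weight g ≤ weight (g ∪ᵇ h)
  weight-∪ˡ g h = count-mono λ v p → let gv , sv = to (T-∧ {g v}) p in from (T-∧ {g v ∨ h v}) (⊆ᵇ-∪ˡ g h v gv , sv)

  weight-∪ : ∀ g h → weight (g ∪ᵇ h) ≤ weight g + weight h
  weight-∪ g h = ≤-trans (≤-reflexive (count-cong λ v → ∧-distribʳ-∨ (S v) (g v) (h v))) (count-∪ (g ∩ᵇ S) (h ∩ᵇ S))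

  ∪-closed : ∀ {g h} → Closed g → Closed h → Closed (g ∪ᵇ h)
  ∪-closed {g} {h} (g⊆ , g-ext) (h⊆ , h-ext) =
      (λ v p → [ g⊆ v , h⊆ v ]′ (to (T-∨ {g v}) p))
    , (λ u v p out e → [ (λ gu → ⊆ᵇ-∪ˡ g h v (g-ext u v gu out e)) , (λ hu → ⊆ᵇ-∪ʳ g h v (h-ext u v hu out e)) ]′
                         (to (T-∨ {g u}) p))

  insert-All : ∀ {Q : (Fin n → Bool) → Set} {K} gs → All Q gs → Q K →
    (∀ {g} → Q g → weight g + weight K ≤ t → Q (g ∪ᵇ K)) → All Q (insert K gs)
  insert-All []       []       qK _     = qK ∷ []
  insert-All {K = K} (g ∷ gs) (qg ∷ qs) qK merge with weight g + weight K ≤? t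
  ... | yes fits = merge qg fits ∷ qs
  ... | no  _    = qg ∷ insert-All gs qs qK merge

  insert-Grouped : ∀ {K} gs → Grouped gs → Closed K → weight K ≤ t → All (Disjointᵇ K) gs → Grouped (insert K gs)
  insert-Grouped [] _ cK wK _ = record { closed = cK ∷ [] ; light = wK ∷ [] ; disjoint = [] ∷ [] ; heavy = [] ∷ [] }
  insert-Grouped {K} (g ∷ gs) record { closed = cg ∷ cs ; light = wg ∷ ws ; disjoint = dg ∷ ds ; heavy = hg ∷ hs }
    cK wK (dKg ∷ dKs) with weight g + weight K ≤? t
  ... | yes fits = record
    { closed   = ∪-closed cg cK ∷ cs
    ; light    = ≤-trans (weight-∪ g K) fits ∷ ws
    ; disjoint = All.zipWith (λ (d₁ , d₂) → Disjointᵇ-∪ˡ d₁ d₂) (dg , dKs) ∷ ds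
    ; heavy    = All.map (λ {h} b → <-≤-trans b (+-monoˡ-≤ (weight h) (weight-∪ˡ g K))) hg ∷ hs
    }
  ... | no heavy = record
    { closed   = cg ∷ Grouped.closed rest
    ; light    = wg ∷ Grouped.light rest
    ; disjoint = insert-All gs dg (Disjointᵇ-sym dKg) (λ d _ → Disjointᵇ-∪ʳ d (Disjointᵇ-sym dKg)) ∷ Grouped.disjoint rest
    ; heavy    = insert-All gs hg (≰⇒> heavy) (λ {h} b _ → <-≤-trans b (+-monoʳ-≤ (weight g) (weight-∪ˡ h K))) ∷ Grouped.heavy rest
    }
    where
      rest = insert-Grouped gs (record { closed = cs ; light = ws ; disjoint = ds ; heavy = hs }) cK wK dKs

  insert-⊇ : ∀ K gs v → T (K v) ⊎ T (⋃ᵇ gs v) → T (⋃ᵇ (insert K gs) v)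
  insert-⊇ K []       v (inj₁ p) = ⊆ᵇ-∪ˡ K _ v p
  insert-⊇ K (g ∷ gs) v p with weight g + weight K ≤? t | p
  ... | yes _ | inj₁ Kv = ⊆ᵇ-∪ˡ (g ∪ᵇ K) (⋃ᵇ gs) v (⊆ᵇ-∪ʳ g K v Kv)
  ... | yes _ | inj₂ q  = [ ⊆ᵇ-∪ˡ (g ∪ᵇ K) (⋃ᵇ gs) v ∘ ⊆ᵇ-∪ˡ g K v , ⊆ᵇ-∪ʳ (g ∪ᵇ K) (⋃ᵇ gs) v ]′ (to (T-∨ {g v}) q)
  ... | no  _ | inj₁ Kv = ⊆ᵇ-∪ʳ g (⋃ᵇ (insert K gs)) v (insert-⊇ K gs v (inj₁ Kv))
  ... | no  _ | inj₂ q  = [ ⊆ᵇ-∪ˡ g (⋃ᵇ (insert K gs)) v , ⊆ᵇ-∪ʳ g (⋃ᵇ (insert K gs)) v ∘ insert-⊇ K gs v ∘ inj₂ ]′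
                            (to (T-∨ {g v}) q)

  uncovered-disjoint : ∀ gs → All Closed gs → ∀ {u} → Outside u → ¬ T (⋃ᵇ gs u) → All (Disjointᵇ (component u)) gs
  uncovered-disjoint []       []        _   _ = []
  uncovered-disjoint (g ∷ gs) (cg ∷ cs) out ¬cov =
      Disjointᵇ-sym (component-disjoint out cg (¬cov ∘ ⊆ᵇ-∪ˡ g (⋃ᵇ gs) _))
    ∷ uncovered-disjoint gs cs out (¬cov ∘ ⊆ᵇ-∪ʳ g (⋃ᵇ gs) _)

  ⋃ᵇ⇒Any : ∀ gs {v} → T (⋃ᵇ gs v) → Any (λ g → T (g v)) gs
  ⋃ᵇ⇒Any (g ∷ gs) {v} p = [ here , there ∘ ⋃ᵇ⇒Any gs ]′ (to (T-∨ {g v}) p)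

  module _ (W : Fin n → Bool) (small : ∀ {u} → Outside u → weight (component u) ≤ t) where

    Candidate : List (Fin n → Bool) → Fin n → Set
    Candidate gs v = T (W v) × ¬ T (S v) × Outside v × ¬ T (⋃ᵇ gs v)

    candidate? : ∀ gs v → Dec (Candidate gs v)
    candidate? gs v = T? (W v) ×-dec ¬? (T? (S v)) ×-dec ¬? (T? (X v)) ×-dec ¬? (T? (⋃ᵇ gs v))

    add : List (Fin n → Bool) → Fin n → List (Fin n → Bool)
    add gs v with candidate? gs v
    ... | yes _ = insert (component v) gs
    ... | no  _ = gs

    add-Grouped : ∀ gs v → Grouped gs → Grouped (add gs v)
    add-Grouped gs v grouped with candidate? gs v
    ... | yes (_ , _ , out , ¬cov) = insert-Grouped gs grouped (component-closed out) (small out)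
                                       (uncovered-disjoint gs (Grouped.closed grouped) out ¬cov)
    ... | no  _ = grouped

    add-⊇ : ∀ gs v → ⋃ᵇ gs ⊆ᵇ ⋃ᵇ (add gs v)
    add-⊇ gs v x p with candidate? gs v
    ... | yes _ = insert-⊇ (component v) gs x (inj₂ p)
    ... | no  _ = p

    add-covers : ∀ gs v → T (W v) → ¬ T (S v) → Outside v → T (⋃ᵇ (add gs v) v)
    add-covers gs v wv ¬sv out with candidate? gs v
    ... | yes _ = insert-⊇ (component v) gs v (inj₁ (component-self v))
    ... | no ¬c with T? (⋃ᵇ gs v)
    ...   | yes cov  = cov
    ...   | no  ¬cov = ⊥-elim (¬c (wv , ¬sv , out , ¬cov))

    foldl-Grouped : ∀ gs vs → Grouped gs → Grouped (foldl add gs vs)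
    foldl-Grouped gs []       grouped = grouped
    foldl-Grouped gs (v ∷ vs) grouped = foldl-Grouped (add gs v) vs (add-Grouped gs v grouped)

    foldl-⊇ : ∀ gs vs → ⋃ᵇ gs ⊆ᵇ ⋃ᵇ (foldl add gs vs)
    foldl-⊇ gs []       x p = p
    foldl-⊇ gs (v ∷ vs) x p = foldl-⊇ (add gs v) vs x (add-⊇ gs v x p)

    foldl-covers : ∀ gs vs {v} → v ∈ₗ vs → T (W v) → ¬ T (S v) → Outside v → T (⋃ᵇ (foldl add gs vs) v)
    foldl-covers gs (v ∷ vs) (here refl) wv ¬sv out = foldl-⊇ (add gs v) vs v (add-covers gs v wv ¬sv out)
    foldl-covers gs (u ∷ vs) (there v∈) wv ¬sv out = foldl-covers (add gs u) vs v∈ wv ¬sv out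

    groups : List (Fin n → Bool)
    groups = foldl add [] (allFin n)

    groups-Grouped : Grouped groups
    groups-Grouped = foldl-Grouped [] (allFin n) (record { closed = [] ; light = [] ; disjoint = [] ; heavy = [] })

    groups-cover : ∀ v → T (W v) → ¬ T (S v) → Outside v → Any (λ g → T (g v)) groups
    groups-cover v wv ¬sv out = ⋃ᵇ⇒Any groups (foldl-covers [] (allFin n) (∈-allFin v) wv ¬sv out)

record Decomposition {n} (G : Graph n) (b d : ℕ) (W A : Fin n → Bool) : Set where
  field
    tree        : RootedTree
    bag         : Tree.Node tree → Fin n → Bool
    bag⊆W       : ∀ x → bag x ⊆ᵇ W
    covers      : ∀ v → T (W v) → ∃ λ x → T (bag x v)
    covers-edge : ∀ u v → T (W u) → T (W v) → Edge G u v → ∃ λ x → T (bag x u) × T (bag x v)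
    connected   : ∀ v → BagsConnected tree bag v
    slick       : ∀ j → SlickStep G (bag (RootedTree.parent tree j)) (bag (suc j))
    A⊆root      : A ⊆ᵇ bag zero
    bag-size    : ∀ x → count (bag x) ≤ b
    root-degree : deg (Tree.graph tree) zero ≤ d
    degree      : ∀ x → deg (Tree.graph tree) x ≤ suc d

single-bag : RootedTree
single-bag = rootedTree 0 (λ ()) (λ ())

single-bag-connected : ∀ {n} (B : Fin n → Bool) v → BagsConnected single-bag (λ _ → B) v
single-bag-connected B v with T? (B v)
... | yes p = inj₁ (zero , p , (λ _ → refl) , λ ())
... | no ¬p = inj₂ (λ _ → ¬p)

trivial-decomposition : ∀ {n} {G : Graph n} {b d W A} → A ⊆ᵇ W → count W ≤ b → Decomposition G b d W A
trivial-decomposition {W = W} A⊆W small = record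
  { tree        = single-bag
  ; bag         = λ _ → W
  ; bag⊆W       = λ _ _ → id
  ; covers      = λ _ p → zero , p
  ; covers-edge = λ _ _ p q _ → zero , p , q
  ; connected   = single-bag-connected W
  ; slick       = λ ()
  ; A⊆root      = A⊆W
  ; bag-size    = λ _ → small
  ; root-degree = z≤n
  ; degree      = λ { zero → z≤n }
  }

All×Any⇒Any : ∀ {A : Set} {P Q : A → Set} {xs} → All P xs → Any Q xs → Any (λ x → P x × Q x) xs
All×Any⇒Any (p ∷ _)  (here q)  = here (p , q)
All×Any⇒Any (_ ∷ ps) (there a) = there (All×Any⇒Any ps a)

module Construction {n} (G : Graph n) (ℓ t′ : ℕ)
  (separate : ∀ S → count S ≡ 2 * suc t′ + 2 * ℓ → Σ (Fin n → Bool) λ X →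
     count X ≤ ℓ × (∀ {u} → ¬ T (X u) → count (Components.component G X u ∩ᵇ S) ≤ suc t′)) where

  t : ℕ
  t = suc t′

  Decomp : (W A : Fin n → Bool) → Set
  Decomp = Decomposition G (2 * t + 3 * ℓ) (3 + ceilDiv (4 * ℓ) t)

  module Separation (W A S X : Fin n → Bool) (A⊆S : A ⊆ᵇ S) (S⊆W : S ⊆ᵇ W)
                    (count-S : count S ≡ 2 * t + 2 * ℓ) (count-X : count X ≤ ℓ) where

    open Components G X
    open Grouping G X S t

    B₀ : Fin n → Bool
    B₀ = S ∪ᵇ (X ∩ᵇ W)

    B₀⊆W : B₀ ⊆ᵇ W
    B₀⊆W v p = [ S⊆W v , proj₂ ∘ to (T-∧ {X v}) ]′ (to (T-∨ {S v}) p)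

    B₀-size : count B₀ ≤ 2 * t + 3 * ℓ
    B₀-size = begin
      count B₀                            ≤⟨ count-∪ S (X ∩ᵇ W) ⟩
      count S + count (X ∩ᵇ W)           ≤⟨ +-mono-≤ (≤-reflexive count-S) (≤-trans (count-mono (λ v → proj₁ ∘ to (T-∧ {X v}))) count-X) ⟩
      2 * t + 2 * ℓ + ℓ                  ≡⟨ shape t ℓ ⟩
      2 * t + 3 * ℓ                      ∎
      where
        open ≤-Reasoning
        shape : ∀ t ℓ → 2 * t + 2 * ℓ + ℓ ≡ 2 * t + 3 * ℓ
        shape = solve-∀

    core : (Fin n → Bool) → Fin n → Bool
    core g = g ∩ᵇ (W ∖ᵇ S)

    core-neighbour : (Fin n → Bool) → Fin n → Fin n → Bool
    core-neighbour g v u = core g u ∧ adj G v u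

    rim : (Fin n → Bool) → Fin n → Bool
    rim g v = B₀ v ∧ ∃ᵇ (core-neighbour g v)

    childW : (Fin n → Bool) → Fin n → Bool
    childW g = core g ∪ᵇ rim g

    -- A core neighbour of the rim vertex v; adding these to the child's root bag makes the edge
    -- into the child slick.
    partner : (Fin n → Bool) → Fin n → Fin n
    partner g v = choose (core-neighbour g v) v

    partners : (Fin n → Bool) → Fin n → Bool
    partners g u = ∃ᵇ (λ v → rim g v ∧ ⁅ partner g v ⁆ᵇ u)

    childA : (Fin n → Bool) → Fin n → Bool
    childA g = rim g ∪ᵇ partners g

    twice : ∀ t ℓ → t + ℓ + (t + ℓ) ≡ 2 * t + 2 * ℓ
    twice = solve-∀

    module _ (g : Fin n → Bool) where

      core⊆g : core g ⊆ᵇ g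
      core⊆g v = proj₁ ∘ to (T-∧ {g v})

      core⊆W : core g ⊆ᵇ W
      core⊆W v = proj₁ ∘ to (T-∧ {W v}) ∘ proj₂ ∘ to (T-∧ {g v})

      core∉S : ∀ v → T (core g v) → ¬ T (S v)
      core∉S v = T-not⇒¬T ∘ proj₂ ∘ to (T-∧ {W v}) ∘ proj₂ ∘ to (T-∧ {g v})

      core∉B₀ : Closed g → ∀ v → T (core g v) → ¬ T (B₀ v)
      core∉B₀ (outside , _) v p q =
        [ core∉S v p , outside v (core⊆g v p) ∘ proj₁ ∘ to (T-∧ {X v}) ]′ (to (T-∨ {S v}) q)

      rim⊆B₀ : rim g ⊆ᵇ B₀
      rim⊆B₀ v = proj₁ ∘ to (T-∧ {B₀ v})

      childW⊆W : childW g ⊆ᵇ W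
      childW⊆W v p = [ core⊆W v , B₀⊆W v ∘ rim⊆B₀ v ]′ (to (T-∨ {core g v}) p)

      partner-spec : ∀ {v} → T (rim g v) → T (core g (partner g v)) × Edge G v (partner g v)
      partner-spec {v} p = to (T-∧ {core g (partner g v)})
        (choose-sound (core-neighbour g v) v (proj₂ (∃ᵇ-sound {f = core-neighbour g v} (proj₂ (to (T-∧ {B₀ v}) p)))))

      rim⊆ : Closed g → rim g ⊆ᵇ (g ∩ᵇ S) ∪ᵇ X
      rim⊆ (_ , extend) v p with T? (X v)
      ... | yes Xv = ⊆ᵇ-∪ʳ (g ∩ᵇ S) X v Xv
      ... | no ¬Xv = ⊆ᵇ-∪ˡ (g ∩ᵇ S) X v (from (T-∧ {g v})
                       (extend _ v (core⊆g _ (proj₁ (partner-spec p))) ¬Xv (edge-sym G (proj₂ (partner-spec p))) , Sv))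
        where
          Sv : T (S v)
          Sv = [ id , ⊥-elim ∘ ¬Xv ∘ proj₁ ∘ to (T-∧ {X v}) ]′ (to (T-∨ {S v}) (rim⊆B₀ v p))

      rim-size : Closed g → weight g ≤ t → count (rim g) ≤ t + ℓ
      rim-size closed light =
        ≤-trans (count-mono (rim⊆ closed)) (≤-trans (count-∪ (g ∩ᵇ S) X) (+-mono-≤ light count-X))

      partners⊆core : partners g ⊆ᵇ core g
      partners⊆core u p with ∃ᵇ-sound p
      ... | v , q with to (T-∧ {rim g v}) q
      ... | rim-v , v↦u = subst (T ∘ core g) (toWitness v↦u) (proj₁ (partner-spec rim-v))

      childA⊆childW : childA g ⊆ᵇ childW g
      childA⊆childW v p =
        [ ⊆ᵇ-∪ʳ (core g) (rim g) v , ⊆ᵇ-∪ˡ (core g) (rim g) v ∘ partners⊆core v ]′ (to (T-∨ {rim g v}) p)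

      childA-size : Closed g → weight g ≤ t → count (childA g) ≤ 2 * t + 2 * ℓ
      childA-size closed light = begin
        count (childA g)                   ≤⟨ count-∪ (rim g) (partners g) ⟩
        count (rim g) + count (partners g) ≤⟨ +-monoʳ-≤ (count (rim g)) (count-image (rim g) (partner g)) ⟩
        count (rim g) + count (rim g)      ≤⟨ +-mono-≤ (rim-size closed light) (rim-size closed light) ⟩
        t + ℓ + (t + ℓ)                    ≡⟨ twice t ℓ ⟩
        2 * t + 2 * ℓ                      ∎
        where open ≤-Reasoning

      childW-smaller : Closed g → weight g ≤ t → count (childW g) < count W
      childW-smaller closed light with count-<-witness (childW g ∩ᵇ S) S few-in-S
        where
          childW∩S⊆rim : childW g ∩ᵇ S ⊆ᵇ rim g
          childW∩S⊆rim v p with to (T-∧ {childW g v}) p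
          ... | q , Sv = [ ⊥-elim ∘ flip (core∉S v) Sv , id ]′ (to (T-∨ {core g v}) q)
          few-in-S : count (childW g ∩ᵇ S) < count S
          few-in-S = begin-strict
            count (childW g ∩ᵇ S)  ≤⟨ count-mono childW∩S⊆rim ⟩
            count (rim g)          ≤⟨ rim-size closed light ⟩
            t + ℓ                  <⟨ m<m+n (t + ℓ) (s≤s z≤n) ⟩
            t + ℓ + (t + ℓ)        ≡⟨ twice t ℓ ⟩
            2 * t + 2 * ℓ          ≡⟨ count-S ⟨
            count S                ∎
            where open ≤-Reasoning
      ... | x , Sx , ¬childW∩S = count-< childW⊆W (S⊆W x Sx) (¬childW∩S ∘ λ p → from (T-∧ {childW g x}) (p , Sx))

    few-groups-in : ∀ hs → AllPairs Heavy hs → AllPairs Disjointᵇ hs → length hs ≤ 3 + ceilDiv (4 * ℓ) t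
    few-groups-in []               _     _        = z≤n
    few-groups-in (_ ∷ [])         _     _        = s≤s z≤n
    few-groups-in hs@(_ ∷ _ ∷ _) heavy disjoint = few-groups ℓ t′ (length hs) (begin
      length hs * suc t            ≤⟨ pairwise-heavy-sum weight t hs heavy (s≤s (s≤s z≤n)) ⟩
      2 * sum (map weight hs)      ≤⟨ *-monoʳ-≤ 2 (sum-count-disjoint S hs disjoint) ⟩
      2 * count S                  ≡⟨ cong (2 *_) count-S ⟩
      2 * (2 * t + 2 * ℓ)          ∎)
      where open ≤-Reasoning

    rim-elsewhere : ∀ g hs → Closed g → All (Disjointᵇ g) hs → ∀ {v} → T (childW g v) →
      T (B₀ v) ⊎ Any (λ h → T (childW h v)) hs → T (rim g v)
    rim-elsewhere g hs closed apart {v} p elsewhere with to (T-∨ {core g v}) p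
    ... | inj₂ rim-v  = rim-v
    ... | inj₁ core-v = ⊥-elim (absurd hs apart elsewhere)
      where
        absurd : ∀ hs → All (Disjointᵇ g) hs → T (B₀ v) ⊎ Any (λ h → T (childW h v)) hs → ⊥
        absurd _        _        (inj₁ rv)         = core∉B₀ g closed v core-v rv
        absurd (h ∷ _)  (d ∷ _)  (inj₂ (here q))  =
          [ d v (core⊆g g v core-v) ∘ core⊆g h v , core∉B₀ g closed v core-v ∘ rim⊆B₀ h v ]′ (to (T-∨ {core h v}) q)
        absurd (_ ∷ hs) (_ ∷ ds) (inj₂ (there q)) = absurd hs ds (inj₂ q)


    module Assembly (gs : List (Fin n → Bool)) (grouped : Grouped gs)
                    (cover : ∀ v → T (W v) → ¬ T (S v) → Outside v → Any (λ g → T (g v)) gs)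
                    (child : ∀ g → Closed g → weight g ≤ t → Decomp (childW g) (childA g)) where

      record Star (hs : List (Fin n → Bool)) : Set where
        field
          tree        : RootedTree
          bag         : Tree.Node tree → Fin n → Bool
          root-bag    : bag zero ≡ B₀
          bag⊆        : ∀ x v → T (bag x v) → T (B₀ v) ⊎ Any (λ h → T (childW h v)) hs
          covers      : ∀ v → Any (λ h → T (childW h v)) hs → ∃ λ x → T (bag x v)
          covers-edge : ∀ u v → Any (λ h → T (childW h u) × T (childW h v)) hs → Edge G u v →
                          ∃ λ x → T (bag x u) × T (bag x v)
          connected   : ∀ v → BagsConnected tree bag v
          slick       : ∀ j → SlickStep G (bag (RootedTree.parent tree j)) (bag (suc j))
          bag-size    : ∀ x → count (bag x) ≤ 2 * t + 3 * ℓ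
          root-degree : deg (Tree.graph tree) zero ≡ length hs
          degree      : ∀ j → deg (Tree.graph tree) (suc j) ≤ 4 + ceilDiv (4 * ℓ) t

      root-star : Star []
      root-star = record
        { tree        = single-bag
        ; bag         = λ _ → B₀
        ; root-bag    = refl
        ; bag⊆        = λ _ _ → inj₁
        ; covers      = λ _ ()
        ; covers-edge = λ _ _ ()
        ; connected   = single-bag-connected B₀
        ; slick       = λ ()
        ; bag-size    = λ _ → B₀-size
        ; root-degree = refl
        ; degree      = λ ()
        }

      module Extend {hs} (star : Star hs) (g : Fin n → Bool) (closed : Closed g) (light : weight g ≤ t)
                    (apart : All (Disjointᵇ g) hs) where
        module A = Star star
        module C = Decomposition (child g closed light)
        open Graft A.tree C.tree

        B₀⊆root : ∀ {v} → T (B₀ v) → T (A.bag zero v)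
        B₀⊆root {v} = subst (λ B → T (B v)) (sym A.root-bag)

        root⊆B₀ : ∀ {v} → T (A.bag zero v) → T (B₀ v)
        root⊆B₀ {v} = subst (λ B → T (B v)) A.root-bag

        shared⊆rim : ∀ {v x y} → T (A.bag x v) → T (C.bag y v) → T (rim g v)
        shared⊆rim {v} {x} {y} p q = rim-elsewhere g hs closed apart (C.bag⊆W y v q) (A.bag⊆ x v p)

        meet : ∀ {v} → (∃ λ x → T (A.bag x v)) → (∃ λ y → T (C.bag y v)) → T (A.bag zero v) × T (C.bag zero v)
        meet {v} (_ , p) (_ , q) = B₀⊆root (rim⊆B₀ g v rim-v) , C.A⊆root v (⊆ᵇ-∪ˡ (rim g) (partners g) v rim-v)
          where rim-v = shared⊆rim p q

        slick-at-root : SlickStep G (A.bag zero) (C.bag zero)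
        slick-at-root v p q =
            partner g v , proj₂ (partner-spec g rim-v)
          , C.A⊆root _ (⊆ᵇ-∪ʳ (rim g) (partners g) _ (∃ᵇ-complete v (from (T-∧ {rim g v}) (rim-v , fromWitness refl))))
          , core∉B₀ g closed _ (proj₁ (partner-spec g rim-v)) ∘ root⊆B₀
          where rim-v = shared⊆rim p q

        extended : Star (g ∷ hs)
        extended = record
          { tree        = graft
          ; bag         = bag A.bag C.bag
          ; root-bag    = A.root-bag
          ; bag⊆        = merge-elim {f = A.bag} {C.bag} (λ B → ∀ v → T (B v) → T (B₀ v) ⊎ Any (λ h → T (childW h v)) (g ∷ hs))
                            (λ x v → map₂ there ∘ A.bag⊆ x v) (λ y v → inj₂ ∘ here ∘ C.bag⊆W y v)
          ; covers      = covers
          ; covers-edge = covers-edge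
          ; connected   = λ v → graft-connected A.bag C.bag v (A.connected v) (C.connected v) meet
          ; slick       = graft-slick A.bag C.bag G A.slick C.slick slick-at-root
          ; bag-size    = merge-elim {f = A.bag} {C.bag} (λ B → count B ≤ 2 * t + 3 * ℓ) A.bag-size C.bag-size
          ; root-degree = trans degree-root (cong suc A.root-degree)
          ; degree      = degree-nonRoot≤ A.degree (s≤s C.root-degree) (C.degree ∘ suc)
          }
          where
            covers : ∀ v → Any (λ h → T (childW h v)) (g ∷ hs) → ∃ λ x → T (bag A.bag C.bag x v)
            covers v (here p) with C.covers v p
            ... | y , q = inB y , fromB A.bag C.bag v y q
            covers v (there p) with A.covers v p
            ... | x , q = inA x , fromA A.bag C.bag v x q

            covers-edge : ∀ u v → Any (λ h → T (childW h u) × T (childW h v)) (g ∷ hs) → Edge G u v →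
              ∃ λ x → T (bag A.bag C.bag x u) × T (bag A.bag C.bag x v)
            covers-edge u v (here (p , q)) e with C.covers-edge u v p q e
            ... | y , pu , pv = inB y , fromB A.bag C.bag u y pu , fromB A.bag C.bag v y pv
            covers-edge u v (there a) e with A.covers-edge u v a e
            ... | x , pu , pv = inA x , fromA A.bag C.bag u x pu , fromA A.bag C.bag v x pv

      star : ∀ hs → All Closed hs → All (λ g → weight g ≤ t) hs → AllPairs Disjointᵇ hs → Star hs
      star []       _         _         _          = root-star
      star (g ∷ hs) (cg ∷ cs) (wg ∷ ws) (dg ∷ ds) = Extend.extended (star hs cs ws ds) g cg wg dg

      S⊆B₀ : S ⊆ᵇ B₀
      S⊆B₀ = ⊆ᵇ-∪ˡ S (X ∩ᵇ W)

      outside-B₀ : ∀ {v} → T (W v) → ¬ T (B₀ v) → Outside v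
      outside-B₀ {v} Wv ¬rv Xv = ¬rv (⊆ᵇ-∪ʳ S (X ∩ᵇ W) v (from (T-∧ {X v}) (Xv , Wv)))

      in-core : ∀ {g v} → T (g v) → T (W v) → ¬ T (B₀ v) → T (core g v)
      in-core {g} {v} gv Wv ¬rv = from (T-∧ {g v}) (gv , from (T-∧ {W v}) (Wv , ¬T⇒T-not (¬rv ∘ S⊆B₀ v)))

      core-of : ∀ {v} → T (W v) → ¬ T (B₀ v) → Any (λ g → Closed g × T (core g v)) gs
      core-of {v} Wv ¬rv = Any.map (λ {g} (closed , gv) → closed , in-core {g} gv Wv ¬rv)
        (All×Any⇒Any (Grouped.closed grouped) (cover v Wv (¬rv ∘ S⊆B₀ v) (outside-B₀ Wv ¬rv)))

      edge-from-core : ∀ {g u v} → Closed g → T (core g u) → T (W v) → Edge G u v → T (childW g u) × T (childW g v)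
      edge-from-core {g} {u} {v} (_ , extend) core-u Wv e = ⊆ᵇ-∪ˡ (core g) (rim g) u core-u , in-childW (T? (B₀ v))
        where
          in-childW : Dec (T (B₀ v)) → T (childW g v)
          in-childW (yes rv)  = ⊆ᵇ-∪ʳ (core g) (rim g) v
                                  (from (T-∧ {B₀ v}) (rv , ∃ᵇ-complete u (from (T-∧ {core g u}) (core-u , edge-sym G e))))
          in-childW (no ¬rv) = ⊆ᵇ-∪ˡ (core g) (rim g) v
                                  (in-core {g} (extend u v (core⊆g g u core-u) (outside-B₀ Wv ¬rv) e) Wv ¬rv)

      decomposition : Decomp W A
      decomposition = record
        { tree        = A*.tree
        ; bag         = A*.bag
        ; bag⊆W       = λ x v → [ B₀⊆W v , Any-childW⊆W ]′ ∘ A*.bag⊆ x v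
        ; covers      = covers
        ; covers-edge = covers-edge
        ; connected   = A*.connected
        ; slick       = A*.slick
        ; A⊆root      = λ v → B₀⊆root ∘ S⊆B₀ v ∘ A⊆S v
        ; bag-size    = A*.bag-size
        ; root-degree = root-degree
        ; degree      = degree
        }
        where
          module A* = Star (star gs (Grouped.closed grouped) (Grouped.light grouped) (Grouped.disjoint grouped))

          B₀⊆root : ∀ {v} → T (B₀ v) → T (A*.bag zero v)
          B₀⊆root {v} = subst (λ B → T (B v)) (sym A*.root-bag)

          Any-childW⊆W : ∀ {hs v} → Any (λ h → T (childW h v)) hs → T (W v)
          Any-childW⊆W {h ∷ _} {v} (here p)  = childW⊆W h v p
          Any-childW⊆W             (there a) = Any-childW⊆W a

          covers : ∀ v → T (W v) → ∃ λ x → T (A*.bag x v)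
          covers v Wv with T? (B₀ v)
          ... | yes rv  = zero , B₀⊆root rv
          ... | no ¬rv = A*.covers v (Any.map (λ {g} (_ , core-v) → ⊆ᵇ-∪ˡ (core g) (rim g) v core-v) (core-of Wv ¬rv))

          covers-edge : ∀ u v → T (W u) → T (W v) → Edge G u v → ∃ λ x → T (A*.bag x u) × T (A*.bag x v)
          covers-edge u v Wu Wv e with T? (B₀ u) | T? (B₀ v)
          ... | yes ru | yes rv  = zero , B₀⊆root ru , B₀⊆root rv
          ... | no ¬ru | _       =
            A*.covers-edge u v (Any.map (λ (closed , core-u) → edge-from-core closed core-u Wv e) (core-of Wu ¬ru)) e
          ... | yes _  | no ¬rv with A*.covers-edge v u
                  (Any.map (λ (closed , core-v) → edge-from-core closed core-v Wu (edge-sym G e)) (core-of Wv ¬rv)) (edge-sym G e)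
          ...   | x , pv , pu = x , pu , pv

          root-degree : deg (Tree.graph A*.tree) zero ≤ 3 + ceilDiv (4 * ℓ) t
          root-degree = subst (_≤ 3 + ceilDiv (4 * ℓ) t) (sym A*.root-degree)
            (few-groups-in gs (Grouped.heavy grouped) (Grouped.disjoint grouped))

          degree : ∀ x → deg (Tree.graph A*.tree) x ≤ 4 + ceilDiv (4 * ℓ) t
          degree zero    = m≤n⇒m≤1+n root-degree
          degree (suc j) = A*.degree j

  pick-S : ∀ {W A} → A ⊆ᵇ W → count A ≤ 2 * t + 2 * ℓ → 2 * t + 3 * ℓ < count W →
    Σ (Fin n → Bool) λ S → A ⊆ᵇ S × S ⊆ᵇ W × count S ≡ 2 * t + 2 * ℓ
  pick-S {W} {A} A⊆W A-small W-large
    with subset-between (2 * t + 2 * ℓ ∸ count A) A⊆W (subst (_≤ count W) (sym (m+[n∸m]≡n A-small)) RS≤W)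
    where
      RS≤W : 2 * t + 2 * ℓ ≤ count W
      RS≤W = ≤-trans (+-monoʳ-≤ (2 * t) (*-monoˡ-≤ ℓ (n≤1+n 2))) (<⇒≤ W-large)
  ... | S , A⊆S , S⊆W , count-S = S , A⊆S , S⊆W , trans count-S (m+[n∸m]≡n A-small)

  split : ∀ {W A} → A ⊆ᵇ W → count A ≤ 2 * t + 2 * ℓ → 2 * t + 3 * ℓ < count W →
    (∀ {W′ A′} → count W′ < count W → A′ ⊆ᵇ W′ → count A′ ≤ 2 * t + 2 * ℓ → Decomp W′ A′) → Decomp W A
  split {W} {A} A⊆W A-small W-large recurse with pick-S A⊆W A-small W-large
  ... | S , A⊆S , S⊆W , count-S with separate S count-S
  ... | X , count-X , component-light =
    Assembly.decomposition (groups W component-light) (groups-Grouped W component-light) (groups-cover W component-light) child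
    where
      open Separation W A S X A⊆S S⊆W count-S count-X
      open Components G X using (Closed)
      open Grouping G X S t using (weight; groups; groups-Grouped; groups-cover)
      child : ∀ g → Closed g → weight g ≤ t → Decomp (childW g) (childA g)
      child g closed light = recurse (childW-smaller g closed light) (childA⊆childW g) (childA-size g closed light)

  build : ∀ f {W A} → count W < f → A ⊆ᵇ W → count A ≤ 2 * t + 2 * ℓ → Decomp W A
  build (suc f) {W} W<f A⊆W A-small with count W ≤? 2 * t + 3 * ℓ
  ... | yes W-small = trivial-decomposition A⊆W W-small
  ... | no  W-large = split A⊆W A-small (≰⇒> W-large) λ W′<W → build f (<-≤-trans W′<W (≤-pred W<f))

separator-ᵇ : ∀ {n} (G : Graph n) {ℓ t s} →
  ((S : Subset n) → ∣ S ∣ ≡ s → Σ (Subset n) λ X → ∣ X ∣ ≤ ℓ ×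
    ((C : Subset n) → IsComponentMinus G X C → ∣ C ∩ S ∣ ≤ t)) →
  ∀ S → count S ≡ s → Σ (Fin n → Bool) λ X →
    count X ≤ ℓ × (∀ {u} → ¬ T (X u) → count (Components.component G X u ∩ᵇ S) ≤ t)
separator-ᵇ G {ℓ} {t} separator S count-S with separator (tabulate S) count-S
... | Xs , size , bound =
    lookup Xs
  , subst (_≤ ℓ) (sym (cong ∣_∣ (tabulate∘lookup Xs))) size
  , λ {u} out → subst (_≤ t) (sym (cong ∣_∣ (tabulate-∩ (component u) S))) (bound _ (component-isComponent Xs refl out))
  where open Components G (lookup Xs)

slick-tree-decomposition : ∀ {n} {G : Graph n} {b d} {R : Subset n} →
  Decomposition G b d (λ _ → true) (lookup R) →
  Σ ℕ λ m → Σ (Graph m) λ Tr → Σ (Fin m) λ r → Σ (Fin m → Subset n) λ B →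
    IsTreeDecomposition G Tr B × IsSlick G Tr r B × R ⊆ B r
    × ((x : Fin m) → ∣ B x ∣ ≤ b) × ((x : Fin m) → deg Tr x ≤ suc d) × deg Tr r ≤ d
slick-tree-decomposition {n} {G} {R = R} D =
  suc (RootedTree.size tree) , graph , zero , B , (isTree , edges , vertices) , slick′ , root ,
  bag-size , degree , root-degree
  where
    open Decomposition D
    open Tree tree

    B : Node → Subset n
    B x = tabulate (bag x)

    edges : ∀ u v → Edge G u v → ∃ λ x → u ∈ B x × v ∈ B x
    edges u v e with covers-edge u v tt tt e
    ... | x , p , q = x , ∈-tabulate⁺ p , ∈-tabulate⁺ q

    vertices : ∀ v → (∃ λ x → v ∈ B x) × ConnectedIn graph (λ x → v ∈ B x)
    vertices v with covers v tt | connected v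
    ... | x , p | inj₁ top = (x , ∈-tabulate⁺ p) , λ y z q r →
          walk-map (λ _ → ∈-tabulate⁺) (HasTop⇒connected top y z (∈-tabulate⁻ q) (∈-tabulate⁻ r))
    ... | x , p | inj₂ nowhere = ⊥-elim (nowhere x p)

    slick′ : IsSlick G graph zero B
    slick′ x y parent v p q with Parent⇒ParentOf parent
    ... | j , refl , refl with slick j v (∈-tabulate⁻ p) (∈-tabulate⁻ q)
    ... | u , e , u∈child , u∉parent = u , e , ∈-tabulate⁺ u∈child , u∉parent ∘ ∈-tabulate⁻

    root : R ⊆ B zero
    root = ∈-tabulate⁺ ∘ A⊆root _ ∘ ∈⇒T-lookup

lemma19 : (ℓ t : ℕ) → 1 ≤ ℓ → 1 ≤ t → {n : ℕ} (G : Graph n) →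
  ((S : Subset n) → ∣ S ∣ ≡ 2 * t + 2 * ℓ →
    Σ (Subset n) λ X → ∣ X ∣ ≤ ℓ ×
      ((C : Subset n) → IsComponentMinus G X C → ∣ C ∩ S ∣ ≤ t)) →
  (R : Subset n) → ∣ R ∣ ≤ 2 * t + 2 * ℓ →
  Σ ℕ λ m → Σ (Graph m) λ T → Σ (Fin m) λ r → Σ (Fin m → Subset n) λ B →
    IsTreeDecomposition G T B × IsSlick G T r B × R ⊆ B r
    × ((x : Fin m) → ∣ B x ∣ ≤ 2 * t + 3 * ℓ)
    × ((x : Fin m) → deg T x ≤ 4 + ceilDiv (4 * ℓ) t)
    × deg T r ≤ 3 + ceilDiv (4 * ℓ) t
lemma19 ℓ (suc t′) _ _ {n} G separator R R-small =
  slick-tree-decomposition (Construction.build G ℓ t′ (separator-ᵇ G separator) (suc n) (s≤s (count≤ _)) (λ _ _ → tt)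
    (subst (_≤ 2 * suc t′ + 2 * ℓ) (sym (cong ∣_∣ (tabulate∘lookup R))) R-small))
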